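{- Consider the Round-Robin protocol with $n$ agents over a finite item set $M$, as described in the context. Let agent $i$ have a normalized, nonnegative submodular objective $f_i$ and a $p_i$-system constraint $\mathcal{I}_i$, and follow the simultaneous greedy policy, ending with sets $S_{i1},S_{i2}$. Let $x^i_1,\dots,x^i_s$ ($s=|S_{i1}|+|S_{i2}|$) be the items selected by agent $i$ in order, let $\tau(r)\in\{1,2\}$ be the index of the set to which $x^i_r$ is added, and let $S_{it}^{(r)}$ ($t\in\{1,2\}$) denote the set $S_{it}$ right before $x^i_r$ is added. Let $O_i^-\in\mathcal{I}_i$, $O_i^-\subseteq M_i$, with $f_i(O_i^-)=\mathrm{OPT}^-_i$, and let $Z=\{x\in O_i^-: f_i(x\,|\,S_{it})<0 \text{ for both } t\in\{1,2\}\}$. Then there is a mapping $\delta: O_i^-\setminus Z\to S_{i1}\cup S_{i2}$ such that for all $r\in[s]$ and $x\in O_i^-\setminus Z$: (1) if $\delta(x)=x^i_r$ then $f_i(x\,|\,S_{it}^{(r)})\le f_i(x^i_r\,|\,S_{i,\tau(r)}^{(r)})$ for both $t\in\{1,2\}$; and (2) $|\delta^{ -1}(x^i_r)|\le n+p_i$.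
   Context: For $f:2^M\to\mathbb{R}$ write $f(x\,|\,S)=f(S\cup\{x\})-f(S)$. An independence system is a family $\mathcal{I}\subseteq 2^M$ containing $\emptyset$ and closed under subsets; a basis of $S$ is a maximal member of $\mathcal{I}$ contained in $S$; $\mathrm{ur}(S)$, $\mathrm{lr}(S)$ are the largest and smallest basis cardinalities of $S$; a $p$-system is an independence system with $\max_{S\subseteq M}\mathrm{ur}(S)/\mathrm{lr}(S)\le p$. Round-Robin protocol: $|M|=m$; initially the available set is $Q=M$; for rounds $r=1,\dots,\lceil m/n\rceil$ and within each round for agents $1,\dots,n$ in order, the current agent (by an arbitrary policy possibly using full information) either selects one item of $Q$, which is removed from $Q$, or selects nothing. Simultaneous greedy policy of agent $i$: maintain $S_{i1},S_{i2}$ (initially empty); at each turn let $A=\{(x,y)\in Q\times\{1,2\}: S_{iy}\cup\{x\}\in\mathcal{I}_i\}$; if $A\ne\emptyset$ pick $(j,\ell)\in\arg\max_{(z,w)\in A} f_i(z\,|\,S_{iw})$, select $j$ and add it to $S_{i\ell}$; otherwise select nothing. $M_i$ is the set of items still available right before agent $i$'s first turn and $\mathrm{OPT}^-_i=\max\{f_i(S): S\in\mathcal{I}_i, S\subseteq M_i\}$.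
   Formalization: The objective $f_i$ takes values in ℚ rather than ℝ, and the parameter $p_i$ of the $p_i$-system is rational. -}

module Defs where

open import Data.Nat using (ℕ; zero; suc; _∸_; NonZero) renaming (_+_ to _+ℕ_; _*_ to _*ℕ_; _/_ to _div_)
open import Data.Nat.DivMod using (_mod_)
open import Data.Integer using (+_)
open import Data.Fin using (Fin; toℕ)
import Data.Fin as Fin
open import Data.Fin.Subset using (Subset; ⊥; ⊤; ⁅_⁆; _∈_; _∉_; _⊆_; _∪_; _∩_; _─_; _-_; ∣_∣)
open import Data.Fin.Subset.Properties using (_∈?_)
open import Data.Rational using (ℚ; 0ℚ; _+_; _*_; _≤_; _<_) renaming (_-_ to _-ℚ_; _/_ to _/ℚ_)
open import Data.Rational.Properties using (_<?_)
open import Data.Bool using (Bool; true; false; _∧_; T; if_then_else_)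
open import Data.Maybe using (Maybe; just; nothing)
open import Data.Vec using (tabulate)
open import Data.Product using (Σ; _×_)
open import Data.Sum using (_⊎_)
open import Relation.Nullary using (¬_)
open import Relation.Nullary.Decidable using (⌊_⌋)
open import Relation.Binary.PropositionalEquality using (_≡_)

toℚ : ℕ → ℚ
toℚ k = (+ k) /ℚ 1

marg : {m : ℕ} → (Subset m → ℚ) → Fin m → Subset m → ℚ
marg f x S = f (S ∪ ⁅ x ⁆) -ℚ f S

Normalized : {m : ℕ} → (Subset m → ℚ) → Set
Normalized f = f ⊥ ≡ 0ℚ

NonNegative : {m : ℕ} → (Subset m → ℚ) → Set
NonNegative f = ∀ S → 0ℚ ≤ f S

Submodular : {m : ℕ} → (Subset m → ℚ) → Set
Submodular f = ∀ A B → f (A ∪ B) + f (A ∩ B) ≤ f A + f B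

Indep : {m : ℕ} → (Subset m → Bool) → Subset m → Set
Indep I S = T (I S)

IsIndependenceSystem : {m : ℕ} → (Subset m → Bool) → Set
IsIndependenceSystem I = Indep I ⊥ × (∀ A B → A ⊆ B → Indep I B → Indep I A)

IsBasis : {m : ℕ} → (Subset m → Bool) → Subset m → Subset m → Set
IsBasis I S B = B ⊆ S × Indep I B × (∀ C → B ⊆ C → C ⊆ S → Indep I C → C ⊆ B)

-- p-system: ur(S) ≤ p · lr(S) for every S, i.e. every two bases B, B' of S
-- satisfy |B| ≤ p |B'|  (the ratio form ur/lr ≤ p, cleared of denominators)
IsPSystem : {m : ℕ} → ℚ → (Subset m → Bool) → Set
IsPSystem p I = IsIndependenceSystem I ×
  (∀ S B B′ → IsBasis I S B → IsBasis I S B′ → toℚ ∣ B ∣ ≤ p * toℚ ∣ B′ ∣)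

-- Turns are numbered k = 0,1,2,... ; turn k belongs to agent (k mod n)
-- (agents 0..n-1 standing for 1..n).  There are ⌈m/n⌉ rounds, i.e.
-- ⌈m/n⌉ · n turns.  A run is described by c : ℕ → Maybe (Fin m), the
-- choice made at turn k (nothing = select nothing).

numTurns : (n m : ℕ) .{{_ : NonZero n}} → ℕ
numTurns n m = ((m +ℕ (n ∸ 1)) div n) *ℕ n

agentOf : (n : ℕ) .{{_ : NonZero n}} → ℕ → Fin n
agentOf n k = k mod n

removeChoice : {m : ℕ} → Maybe (Fin m) → Subset m → Subset m
removeChoice nothing  Q = Q
removeChoice (just x) Q = Q - x

avail : {m : ℕ} → (ℕ → Maybe (Fin m)) → ℕ → Subset m
avail c zero    = ⊤
avail c (suc k) = removeChoice (c k) (avail c k)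

ValidRun : (n m : ℕ) .{{_ : NonZero n}} → (ℕ → Maybe (Fin m)) → Set
ValidRun n m c = ∀ k x → k Data.Nat.< numTurns n m → c k ≡ just x → x ∈ avail c k

addIf : {m : ℕ} → Bool → Maybe (Fin m) → Subset m → Subset m
addIf true  (just x) S = S ∪ ⁅ x ⁆
addIf _     _        S = S

-- agent i's set S_{i,y} right before turn k, where ℓ k ∈ {0,1} (standing
-- for {1,2}) records to which of its two sets agent i adds its choice at turn k
greedySet : (n m : ℕ) .{{_ : NonZero n}} → (ℕ → Maybe (Fin m)) → Fin n →
            (ℕ → Fin 2) → Fin 2 → ℕ → Subset m
greedySet n m c i ℓ y zero    = ⊥
greedySet n m c i ℓ y (suc k) =
  addIf (⌊ agentOf n k Fin.≟ i ⌋ ∧ ⌊ ℓ k Fin.≟ y ⌋) (c k) (greedySet n m c i ℓ y k)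

GreedyTurn : (n m : ℕ) .{{_ : NonZero n}} → (ℕ → Maybe (Fin m)) → Fin n →
             (Subset m → ℚ) → (Subset m → Bool) → (ℕ → Fin 2) → ℕ → Set
GreedyTurn n m c i f I ℓ k =
  (c k ≡ nothing × (∀ x y → x ∈ avail c k → ¬ Indep I (S y ∪ ⁅ x ⁆)))
  ⊎ Σ (Fin m) (λ j → c k ≡ just j × j ∈ avail c k × Indep I (S (ℓ k) ∪ ⁅ j ⁆) ×
      (∀ z w → z ∈ avail c k → Indep I (S w ∪ ⁅ z ⁆) → marg f z (S w) ≤ marg f j (S (ℓ k))))
  where
    S : Fin 2 → Subset m
    S y = greedySet n m c i ℓ y k

FollowsGreedy : (n m : ℕ) .{{_ : NonZero n}} → (ℕ → Maybe (Fin m)) → Fin n →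
                (Subset m → ℚ) → (Subset m → Bool) → (ℕ → Fin 2) → Set
FollowsGreedy n m c i f I ℓ =
  ∀ k → k Data.Nat.< numTurns n m → agentOf n k ≡ i → GreedyTurn n m c i f I ℓ k

finalSet : (n m : ℕ) .{{_ : NonZero n}} → (ℕ → Maybe (Fin m)) → Fin n →
           (ℕ → Fin 2) → Fin 2 → Subset m
finalSet n m c i ℓ y = greedySet n m c i ℓ y (numTurns n m)

Zset : (n m : ℕ) .{{_ : NonZero n}} → (ℕ → Maybe (Fin m)) → Fin n →
       (Subset m → ℚ) → (ℕ → Fin 2) → Subset m → Subset m
Zset n m c i f ℓ O = O ∩ tabulate (λ x →
  ⌊ marg f x (finalSet n m c i ℓ Fin.zero) <? 0ℚ ⌋ ∧
  ⌊ marg f x (finalSet n m c i ℓ (Fin.suc Fin.zero)) <? 0ℚ ⌋)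

preimage : {m : ℕ} → (Fin m → Fin m) → Fin m → Subset m → Subset m
preimage δ y D = tabulate (λ x → ⌊ x ∈? D ⌋ ∧ ⌊ δ x Fin.≟ y ⌋)

-- Agent i moves once per round r, at turn toℕ i + r n. Call an item x of O addable at a turn if
-- it is still available and can be added to both of the agent's sets. Addability can only be lost,
-- so x is addable exactly during its first lifetime(x) rounds, and whenever the agent moves while x
-- is addable the greedy rule picks an item whose marginal value dominates that of x for both sets.
-- An x that has expired by round r was, at the agent's turn of round r, either taken by another
-- agent (at most (n - 1) r items) or blocked by one of the sets S_t: it lies in S_t or cannot be
-- added to it. S_t is a basis of its union with the independent set of elements of O it blocks, so
-- the p-system property bounds their number by p |S_t| < (⌊p⌋ + 1) |S_t|, and |S_1| + |S_2| ≤ r.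
-- Hence at most C r elements of O expire by round r, where C = n + ⌊p⌋. Ranking O by lifetime and
-- charging the element of rank q to the agent's pick in round ⌊q / C⌋ thus charges every x to a
-- pick made while x is still addable, and at most C ≤ n + p elements to each pick.

module Submission where

open import Defs
open import Data.Bool using (Bool; true; false; _∧_; if_then_else_)
open import Data.Fin using (Fin; toℕ; punchOut) renaming (zero to 0F; suc to 1+F)
import Data.Fin as Fin
import Data.Fin.Properties as FinP
open import Data.Fin.Subset using (Subset; inside; outside; ⊥; ⁅_⁆; _∈_; _∉_; _⊆_; _∪_; _─_; _-_; ∣_∣)
import Data.Fin.Subset.Properties as SubP
open import Data.Integer using (+_; -[1+_])
import Data.Integer as ℤ
import Data.Integer.Properties as ℤP
open import Data.Maybe using (Maybe; just; nothing; fromMaybe)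
open import Data.Maybe.Properties using (just-injective)
open import Data.Nat using (ℕ; zero; suc; NonZero; z≤n; s≤s; pred; _∸_; _<_) renaming (_+_ to _+ℕ_; _*_ to _*ℕ_; _≤_ to _≤ℕ_; _/_ to _div_)
open import Data.Nat.DivMod using (_%_; _mod_; m≡m%n+[m/n]*n; [m+kn]%n≡m%n; m<n⇒m%n≡m; m%n<n; m<n*o⇒m/o<n)
import Data.Nat.Properties as ℕP
import Data.Nat.Solver
open import Data.Nat.Coprimality using (1-coprimeTo) renaming (sym to coprime-sym)
open import Data.Product using (Σ; _×_; _,_; proj₁; proj₂)
open import Data.Rational using (ℚ; mkℚ; ↥_; 0ℚ; 1ℚ; _+_; _*_; _≤_; *≤*; *<*) renaming (_<_ to _<ℚ_)
import Data.Rational.Properties as ℚP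
open import Data.Sum using (_⊎_; inj₁; inj₂)
open import Data.Vec using (_∷_; []; tabulate)
open import Data.Vec.Base using (here; there)
open import Data.Vec.Properties using (lookup∘tabulate; []=⇒lookup; lookup⇒[]=)
open import Function using (_∘_; id; flip)
open import Level using (Level)
open import Relation.Binary using (Rel; Reflexive; Transitive; tri<; tri≈; tri>)
open import Relation.Binary.PropositionalEquality using (_≡_; _≢_; refl; sym; trans; cong; cong₂; subst; subst₂; module ≡-Reasoning)
open import Relation.Nullary using (Dec; ¬_; ¬?; yes; no; contradiction; _×-dec_; _⊎-dec_; T?)
open import Relation.Nullary.Decidable using (⌊_⌋; isYes≗does; dec-true; dec-false; decidable-stable)
open import Relation.Unary using (Pred; Decidable)

private variable
  a b : Level
  m : ℕ

-- Decidable subsets and their sizes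

⌊⌋-true : ∀ {A : Set a} (a? : Dec A) → A → ⌊ a? ⌋ ≡ true
⌊⌋-true a? a = trans (isYes≗does a?) (dec-true a? a)

⌊⌋-false : ∀ {A : Set a} (a? : Dec A) → ¬ A → ⌊ a? ⌋ ≡ false
⌊⌋-false a? ¬a = trans (isYes≗does a?) (dec-false a? ¬a)

select : {P : Pred (Fin m) a} → Decidable P → Subset m
select P? = tabulate (λ x → ⌊ P? x ⌋)

module _ {P : Pred (Fin m) a} (P? : Decidable P) where

  ∈-select⁺ : ∀ {x} → P x → x ∈ select P?
  ∈-select⁺ {x} px = lookup⇒[]= x _ (trans (lookup∘tabulate _ x) (⌊⌋-true (P? x) px))

  ∈-select⁻ : ∀ {x} → x ∈ select P? → P x
  ∈-select⁻ {x} x∈ with P? x | trans (sym (lookup∘tabulate (λ z → ⌊ P? z ⌋) x)) ([]=⇒lookup x∈)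
  ... | yes px | _ = px

∈preimage⁻ : ∀ {δ : Fin m → Fin m} {y D x} → x ∈ preimage δ y D → x ∈ D × δ x ≡ y
∈preimage⁻ {δ = δ} {y} {D} {x} x∈
  with x SubP.∈? D | δ x Fin.≟ y | trans (sym (lookup∘tabulate _ x)) ([]=⇒lookup x∈)
... | yes x∈D | yes δx≡y | _ = x∈D , δx≡y

p∪⁅x⁆⊆q : ∀ {p q : Subset m} {x} → p ⊆ q → x ∈ q → p ∪ ⁅ x ⁆ ⊆ q
p∪⁅x⁆⊆q {p = p} p⊆q x∈q y∈ with SubP.x∈p∪q⁻ p _ y∈
... | inj₁ y∈p = p⊆q y∈p
... | inj₂ y∈⁅x⁆ rewrite SubP.x∈⁅y⁆⇒x≡y _ y∈⁅x⁆ = x∈q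

∣p∣<∣p∪⁅x⁆∣ : ∀ {p : Subset m} {x} → x ∉ p → ∣ p ∣ < ∣ p ∪ ⁅ x ⁆ ∣
∣p∣<∣p∪⁅x⁆∣ {p = p} {x} x∉p = SubP.p⊂q⇒∣p∣<∣q∣ (SubP.p⊆p∪q _ , x , SubP.q⊆p∪q p _ (SubP.x∈⁅x⁆ x) , x∉p)

∣p∪q∣≤∣p∣+∣q∣ : (p q : Subset m) → ∣ p ∪ q ∣ ≤ℕ ∣ p ∣ +ℕ ∣ q ∣
∣p∪q∣≤∣p∣+∣q∣ [] [] = z≤n
∣p∪q∣≤∣p∣+∣q∣ (outside ∷ p) (outside ∷ q) = ∣p∪q∣≤∣p∣+∣q∣ p q
∣p∪q∣≤∣p∣+∣q∣ (outside ∷ p) (inside ∷ q) =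
  ℕP.≤-trans (s≤s (∣p∪q∣≤∣p∣+∣q∣ p q)) (ℕP.≤-reflexive (sym (ℕP.+-suc ∣ p ∣ ∣ q ∣)))
∣p∪q∣≤∣p∣+∣q∣ (inside ∷ p) (outside ∷ q) = s≤s (∣p∪q∣≤∣p∣+∣q∣ p q)
∣p∪q∣≤∣p∣+∣q∣ (inside ∷ p) (inside ∷ q) =
  s≤s (ℕP.≤-trans (∣p∪q∣≤∣p∣+∣q∣ p q) (ℕP.+-monoʳ-≤ ∣ p ∣ (ℕP.n≤1+n ∣ q ∣)))

injective⇒∣p∣≤ : ∀ {k} (A : Subset m) (g : ∀ x → x ∈ A → Fin k) →
                  (∀ {x z} (x∈A : x ∈ A) (z∈A : z ∈ A) → g x x∈A ≡ g z z∈A → x ≡ z) → ∣ A ∣ ≤ℕ k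
injective⇒∣p∣≤ [] g inj = z≤n
injective⇒∣p∣≤ (outside ∷ A) g inj =
  injective⇒∣p∣≤ A (λ x x∈A → g (1+F x) (there x∈A))
                   (λ x∈A z∈A → FinP.suc-injective ∘ inj (there x∈A) (there z∈A))
injective⇒∣p∣≤ {k = zero} (inside ∷ A) g inj with g 0F here
... | ()
injective⇒∣p∣≤ {k = suc k} (inside ∷ A) g inj = s≤s (injective⇒∣p∣≤ A g′ inj′)
  where
  g0≢ : ∀ x (x∈A : x ∈ A) → g 0F here ≢ g (1+F x) (there x∈A)
  g0≢ x x∈A eq with inj here (there x∈A) eq
  ... | ()
  g′ : ∀ x → x ∈ A → Fin k
  g′ x x∈A = punchOut (g0≢ x x∈A)
  inj′ : ∀ {x z} (x∈A : x ∈ A) (z∈A : z ∈ A) → g′ x x∈A ≡ g′ z z∈A → x ≡ z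
  inj′ x∈A z∈A eq =
    FinP.suc-injective (inj (there x∈A) (there z∈A) (FinP.punchOut-injective (g0≢ _ x∈A) (g0≢ _ z∈A) eq))

-- Arithmetic on ℕ

/-%-injective : ∀ {a b d} .{{_ : NonZero d}} → a div d ≡ b div d → a % d ≡ b % d → a ≡ b
/-%-injective {a} {b} {d} a/d≡b/d a%d≡b%d = begin
  a                           ≡⟨ m≡m%n+[m/n]*n a d ⟩
  a % d +ℕ a div d *ℕ d       ≡⟨ cong₂ (λ r q → r +ℕ q *ℕ d) a%d≡b%d a/d≡b/d ⟩
  b % d +ℕ b div d *ℕ d       ≡⟨ m≡m%n+[m/n]*n b d ⟨
  b                           ∎
  where open ≡-Reasoning

module _ {A : Set a} {_∼_ : Rel A b} (∼-refl : Reflexive _∼_) (∼-trans : Transitive _∼_)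
         (f : ℕ → A) (step : ∀ k → f k ∼ f (suc k)) where

  suc-monotone⇒monotone : ∀ {k k′} → k ≤ℕ k′ → f k ∼ f k′
  suc-monotone⇒monotone {k′ = zero} z≤n = ∼-refl
  suc-monotone⇒monotone {k} {suc k′} k≤1+k′ with ℕP.m≤n⇒m<n∨m≡n k≤1+k′
  ... | inj₁ k<1+k′ = ∼-trans (suc-monotone⇒monotone (ℕP.≤-pred k<1+k′)) (step k′)
  ... | inj₂ refl   = ∼-refl

prefixLength : {P : Pred ℕ a} → Decidable P → ℕ → ℕ
prefixLength P? zero = zero
prefixLength P? (suc R) with P? 0
... | yes _ = suc (prefixLength (P? ∘ suc) R)
... | no _  = zero

prefixLength≤ : ∀ {P : Pred ℕ a} (P? : Decidable P) R → prefixLength P? R ≤ℕ R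
prefixLength≤ P? zero = z≤n
prefixLength≤ P? (suc R) with P? 0
... | yes _ = s≤s (prefixLength≤ (P? ∘ suc) R)
... | no _  = z≤n

<prefixLength⇒ : ∀ {P : Pred ℕ a} (P? : Decidable P) R {j} → j < prefixLength P? R → P j
<prefixLength⇒ P? (suc R) {j} j< with P? 0
<prefixLength⇒ P? (suc R) {zero}  j<       | yes p0 = p0
<prefixLength⇒ P? (suc R) {suc j} (s≤s j<) | yes _  = <prefixLength⇒ (P? ∘ suc) R j<

prefixLength-stops : ∀ {P : Pred ℕ a} (P? : Decidable P) R → prefixLength P? R < R → ¬ P (prefixLength P? R)
prefixLength-stops P? (suc R) len<R with P? 0
... | yes _  = prefixLength-stops (P? ∘ suc) R (ℕP.≤-pred len<R)
... | no ¬p0 = ¬p0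

prefixLength≤⇒¬ : ∀ {P : Pred ℕ a} (P? : Decidable P) → (∀ {j k} → j ≤ℕ k → P k → P j) →
                  ∀ R {j} → prefixLength P? R ≤ℕ j → j < R → ¬ P j
prefixLength≤⇒¬ P? antitone R len≤j j<R pj =
  prefixLength-stops P? R (ℕP.≤-<-trans len≤j j<R) (antitone len≤j pj)

module LexKey (h : Fin m → ℕ) where

  lexKey : Fin m → ℕ
  lexKey x = h x *ℕ m +ℕ toℕ x

  lexKey-< : ∀ {x z} → h x < h z → lexKey x < lexKey z
  lexKey-< {x} {z} hx<hz = begin-strict
    h x *ℕ m +ℕ toℕ x  <⟨ ℕP.+-monoʳ-< (h x *ℕ m) (FinP.toℕ<n x) ⟩
    h x *ℕ m +ℕ m      ≡⟨ ℕP.+-comm (h x *ℕ m) m ⟩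
    suc (h x) *ℕ m     ≤⟨ ℕP.*-monoˡ-≤ m hx<hz ⟩
    h z *ℕ m           ≤⟨ ℕP.m≤m+n (h z *ℕ m) (toℕ z) ⟩
    lexKey z           ∎
    where open ℕP.≤-Reasoning

  lexKey-<⇒≤ : ∀ {x z} → lexKey z < lexKey x → h z ≤ℕ h x
  lexKey-<⇒≤ {x} {z} kz<kx = ℕP.≮⇒≥ (λ hx<hz → ℕP.<-asym kz<kx (lexKey-< hx<hz))

  lexKey-injective : ∀ {x z} → lexKey x ≡ lexKey z → x ≡ z
  lexKey-injective {x} {z} eq with ℕP.<-cmp (h x) (h z)
  ... | tri< hx<hz _ _ = contradiction eq (ℕP.<⇒≢ (lexKey-< hx<hz))
  ... | tri> _ _ hz<hx = contradiction (sym eq) (ℕP.<⇒≢ (lexKey-< hz<hx))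
  ... | tri≈ _ hx≡hz _ = FinP.toℕ-injective
    (ℕP.+-cancelˡ-≡ (h x *ℕ m) (toℕ x) (toℕ z) (trans eq (cong (λ v → v *ℕ m +ℕ toℕ z) (sym hx≡hz))))

module Rank (O : Subset m) (key : Fin m → ℕ) where

  keyBelow? : ∀ x z → Dec (z ∈ O × key z < key x)
  keyBelow? x z = z SubP.∈? O ×-dec key z ℕP.<? key x

  keyBelow : Fin m → Subset m
  keyBelow x = select (keyBelow? x)

  rank : Fin m → ℕ
  rank x = ∣ keyBelow x ∣

  rank-< : ∀ {x z} → z ∈ O → key z < key x → rank z < rank x
  rank-< {x} {z} z∈O kz<kx =
    SubP.p⊂q⇒∣p∣<∣q∣ (below-z⊆below-x , z , ∈-select⁺ (keyBelow? x) (z∈O , kz<kx) , z∉below-z)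
    where
    below-z⊆below-x : keyBelow z ⊆ keyBelow x
    below-z⊆below-x w∈ with ∈-select⁻ (keyBelow? z) w∈
    ... | w∈O , kw<kz = ∈-select⁺ (keyBelow? x) (w∈O , ℕP.<-trans kw<kz kz<kx)
    z∉below-z : z ∉ keyBelow z
    z∉below-z z∈ = ℕP.<-irrefl refl (proj₂ (∈-select⁻ (keyBelow? z) z∈))

  rank-injective : (∀ {x z} → key x ≡ key z → x ≡ z) →
                   ∀ {x z} → x ∈ O → z ∈ O → rank x ≡ rank z → x ≡ z
  rank-injective key-injective {x} {z} x∈O z∈O eq with ℕP.<-cmp (key x) (key z)
  ... | tri< kx<kz _ _ = contradiction eq (ℕP.<⇒≢ (rank-< x∈O kx<kz))
  ... | tri> _ _ kz<kx = contradiction (sym eq) (ℕP.<⇒≢ (rank-< z∈O kz<kx))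
  ... | tri≈ _ kx≡kz _ = key-injective kx≡kz

-- Natural numbers inside ℚ

toℚ≡mkℚ : ∀ k → toℚ k ≡ mkℚ (+ k) 0 (coprime-sym (1-coprimeTo k))
toℚ≡mkℚ k = ℚP.normalize-coprime (coprime-sym (1-coprimeTo k))

toℚ-mono-≤ : ∀ {k l} → k ≤ℕ l → toℚ k ≤ toℚ l
toℚ-mono-≤ {k} {l} k≤l rewrite toℚ≡mkℚ k | toℚ≡mkℚ l =
  *≤* (subst₂ ℤ._≤_ (sym (ℤP.*-identityʳ (+ k))) (sym (ℤP.*-identityʳ (+ l))) (ℤ.+≤+ k≤l))

toℚ-cancel-≤ : ∀ {k l} → toℚ k ≤ toℚ l → k ≤ℕ l
toℚ-cancel-≤ {k} {l} k≤l rewrite toℚ≡mkℚ k | toℚ≡mkℚ l with k≤l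
... | *≤* k*1≤l*1 rewrite ℤP.*-identityʳ (+ k) | ℤP.*-identityʳ (+ l) = ℤP.drop‿+≤+ k*1≤l*1

toℚ-+ : ∀ k l → toℚ (k +ℕ l) ≡ toℚ k + toℚ l
toℚ-+ k l = trans (cong (Data.Rational._/ 1) numerators) (sym (cong₂ _+_ (toℚ≡mkℚ k) (toℚ≡mkℚ l)))
  where
  numerators : + (k +ℕ l) ≡ + k ℤ.* + 1 ℤ.+ + l ℤ.* + 1
  numerators = trans (ℤP.pos-+ k l) (sym (cong₂ ℤ._+_ (ℤP.*-identityʳ (+ k)) (ℤP.*-identityʳ (+ l))))

toℚ-* : ∀ k l → toℚ (k *ℕ l) ≡ toℚ k * toℚ l
toℚ-* k l = trans (cong (Data.Rational._/ 1) (ℤP.pos-* k l)) (sym (cong₂ _*_ (toℚ≡mkℚ k) (toℚ≡mkℚ l)))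

p<toℚ[1+∣↥p∣] : ∀ p → p <ℚ toℚ (suc ℤ.∣ ↥ p ∣)
p<toℚ[1+∣↥p∣] (mkℚ (+ k) d-1 _) rewrite toℚ≡mkℚ (suc k) = *<* (begin-strict
  + k ℤ.* + 1            ≡⟨ ℤP.*-identityʳ (+ k) ⟩
  + k                    <⟨ ℤ.+<+ (ℕP.n<1+n k) ⟩
  + suc k                ≤⟨ ℤ.+≤+ (ℕP.m≤m*n (suc k) (suc d-1)) ⟩
  + (suc k *ℕ suc d-1)   ≡⟨ ℤP.pos-* (suc k) (suc d-1) ⟩
  + suc k ℤ.* + suc d-1  ∎)
  where open ℤP.≤-Reasoning
p<toℚ[1+∣↥p∣] (mkℚ -[1+ k ] d-1 _) rewrite toℚ≡mkℚ (suc (suc k)) = *<* ℤ.-<+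

floorUpTo : ℚ → ℕ → ℕ
floorUpTo p zero    = zero
floorUpTo p (suc b) = if ⌊ toℚ (suc b) ℚP.≤? p ⌋ then suc b else floorUpTo p b

-- The case split on toℚ (suc b) ≤? p goes through a helper: with-abstracting it makes Agda try to
-- normalise toℚ (suc b), which exhausts memory.
toℚ[floorUpTo]≤p : ∀ {p} b → 0ℚ ≤ p → toℚ (floorUpTo p b) ≤ p
toℚ[floorUpTo]≤p zero 0≤p = 0≤p
toℚ[floorUpTo]≤p {p} (suc b) 0≤p = step (toℚ (suc b) ℚP.≤? p)
  where
  step : (b+1≤?p : Dec (toℚ (suc b) ≤ p)) → toℚ (if ⌊ b+1≤?p ⌋ then suc b else floorUpTo p b) ≤ p
  step (yes b+1≤p) = b+1≤p
  step (no _)      = toℚ[floorUpTo]≤p b 0≤p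

p<toℚ[1+floorUpTo] : ∀ {p} b → p <ℚ toℚ (suc b) → p <ℚ toℚ (suc (floorUpTo p b))
p<toℚ[1+floorUpTo] zero p<1 = p<1
p<toℚ[1+floorUpTo] {p} (suc b) p<b+2 = step (toℚ (suc b) ℚP.≤? p)
  where
  step : (b+1≤?p : Dec (toℚ (suc b) ≤ p)) → p <ℚ toℚ (suc (if ⌊ b+1≤?p ⌋ then suc b else floorUpTo p b))
  step (yes _)      = p<b+2
  step (no b+1≰p) = p<toℚ[1+floorUpTo] b (ℚP.≰⇒> b+1≰p)

⌊_⌋ℕ : ℚ → ℕ
⌊ p ⌋ℕ = floorUpTo p ℤ.∣ ↥ p ∣

toℚ⌊p⌋ℕ≤p : ∀ {p} → 0ℚ ≤ p → toℚ ⌊ p ⌋ℕ ≤ p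
toℚ⌊p⌋ℕ≤p {p} = toℚ[floorUpTo]≤p ℤ.∣ ↥ p ∣

p<toℚ[1+⌊p⌋ℕ] : ∀ p → p <ℚ toℚ (suc ⌊ p ⌋ℕ)
p<toℚ[1+⌊p⌋ℕ] p = p<toℚ[1+floorUpTo] ℤ.∣ ↥ p ∣ (p<toℚ[1+∣↥p∣] p)

toℚ≤p*toℚ⇒≤ : ∀ {p k l} c → toℚ k ≤ p * toℚ l → p ≤ toℚ c → k ≤ℕ c *ℕ l
toℚ≤p*toℚ⇒≤ {p} {k} {l} c k≤pl p≤c = toℚ-cancel-≤ (begin
  toℚ k          ≤⟨ k≤pl ⟩
  p * toℚ l      ≤⟨ ℚP.*-monoʳ-≤-nonNeg (toℚ l) {{Data.Rational.nonNegative (toℚ-mono-≤ {0} {l} z≤n)}} p≤c ⟩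
  toℚ c * toℚ l  ≡⟨ toℚ-* c l ⟨
  toℚ (c *ℕ l)   ∎)
  where open ℚP.≤-Reasoning

-- Independence systems

module _ {I : Subset m → Bool} (hereditary : ∀ A B → A ⊆ B → Indep I B → Indep I A) (U : Subset m) where

  private
    Extends : Subset m → Fin m → Set
    Extends A x = x ∈ U × x ∉ A × Indep I (A ∪ ⁅ x ⁆)

    extends? : ∀ A → Decidable (Extends A)
    extends? A x = x SubP.∈? U ×-dec ¬? (x SubP.∈? A) ×-dec T? (I (A ∪ ⁅ x ⁆))

    extend : ∀ fuel A → m ≤ℕ fuel +ℕ ∣ A ∣ → A ⊆ U → Indep I A → Σ (Subset m) λ B → IsBasis I U B × A ⊆ B
    extend fuel A m≤ A⊆U indA with FinP.any? (extends? A)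
    ... | no ¬ext = A , (A⊆U , indA , maximal) , id
      where
      maximal : ∀ C → A ⊆ C → C ⊆ U → Indep I C → C ⊆ A
      maximal C A⊆C C⊆U indC {x} x∈C with x SubP.∈? A
      ... | yes x∈A = x∈A
      ... | no x∉A  = contradiction (x , C⊆U x∈C , x∉A , hereditary _ C (p∪⁅x⁆⊆q A⊆C x∈C) indC) ¬ext
    ... | yes (x , x∈U , x∉A , indA+x) with fuel
    ...   | zero     = contradiction (ℕP.≤-trans (SubP.∣p∣≤n (A ∪ ⁅ x ⁆)) m≤) (ℕP.<⇒≱ (∣p∣<∣p∪⁅x⁆∣ x∉A))
    ...   | suc fuel with extend fuel (A ∪ ⁅ x ⁆) m≤′ (p∪⁅x⁆⊆q A⊆U x∈U) indA+x
      where
      m≤′ : m ≤ℕ fuel +ℕ ∣ A ∪ ⁅ x ⁆ ∣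
      m≤′ = ℕP.≤-trans m≤ (ℕP.≤-trans (ℕP.≤-reflexive (sym (ℕP.+-suc fuel ∣ A ∣)))
                                      (ℕP.+-monoʳ-≤ fuel (∣p∣<∣p∪⁅x⁆∣ x∉A)))
    ...     | B , basis , A+x⊆B = B , basis , A+x⊆B ∘ SubP.p⊆p∪q _

  extendToBasis : ∀ A → A ⊆ U → Indep I A → Σ (Subset m) λ B → IsBasis I U B × A ⊆ B
  extendToBasis A = extend m A (ℕP.m≤m+n m ∣ A ∣)

module _ {p : ℚ} {I : Subset m → Bool} (isP : IsPSystem p I) where

  private
    hereditary : ∀ A B → A ⊆ B → Indep I B → Indep I A
    hereditary = proj₂ (proj₁ isP)

  ∣blocked∣≤p*∣S∣ : ∀ {S Y} → Indep I S → Indep I Y → (∀ {z} → z ∈ Y → z ∈ S ⊎ ¬ Indep I (S ∪ ⁅ z ⁆)) →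
                     toℚ ∣ Y ∣ ≤ p * toℚ ∣ S ∣
  ∣blocked∣≤p*∣S∣ {S} {Y} indS indY blocked with extendToBasis hereditary (S ∪ Y) Y (SubP.q⊆p∪q S Y) indY
  ... | B , B-basis , Y⊆B =
    ℚP.≤-trans (toℚ-mono-≤ (SubP.p⊆q⇒∣p∣≤∣q∣ Y⊆B)) (proj₂ isP (S ∪ Y) B S B-basis S-basis)
    where
    maximal : ∀ C → S ⊆ C → C ⊆ S ∪ Y → Indep I C → C ⊆ S
    maximal C S⊆C C⊆S∪Y indC {z} z∈C with SubP.x∈p∪q⁻ S Y (C⊆S∪Y z∈C)
    ... | inj₁ z∈S = z∈S
    ... | inj₂ z∈Y with blocked z∈Y
    ...   | inj₁ z∈S      = z∈S
    ...   | inj₂ S+z-dep = contradiction (hereditary _ C (p∪⁅x⁆⊆q S⊆C z∈C) indC) S+z-dep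
    S-basis : IsBasis I (S ∪ Y) S
    S-basis = SubP.p⊆p∪q Y , indS , maximal


  1≤p : ∀ {x} → Indep I ⁅ x ⁆ → 1ℚ ≤ p
  1≤p {x} ind = subst (1ℚ ≤_) (ℚP.*-identityʳ p)
    (subst (λ k → toℚ k ≤ p * toℚ k) (SubP.∣⁅x⁆∣≡1 x) (proj₂ isP ⁅ x ⁆ ⁅ x ⁆ ⁅ x ⁆ basis basis))
    where
    basis : IsBasis I ⁅ x ⁆ ⁅ x ⁆
    basis = id , ind , λ _ _ C⊆⁅x⁆ _ → C⊆⁅x⁆

-- Round-Robin turns and runs

module Turns (n : ℕ) .{{_ : NonZero n}} (i : Fin n) where

  turn : ℕ → ℕ
  turn r = r *ℕ n +ℕ toℕ i

  rounds : ℕ → ℕ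
  rounds m = (m +ℕ (n ∸ 1)) div n

  agentOf≡i⇒% : ∀ {k} → agentOf n k ≡ i → k % n ≡ toℕ i
  agentOf≡i⇒% {k} eq = trans (sym (FinP.toℕ-fromℕ< (m%n<n k n))) (cong toℕ eq)

  %≡⇒agentOf≡i : ∀ {k} → k % n ≡ toℕ i → agentOf n k ≡ i
  %≡⇒agentOf≡i {k} eq = FinP.toℕ-injective (trans (FinP.toℕ-fromℕ< (m%n<n k n)) eq)

  [j+turn]%n : ∀ r j → (j +ℕ turn r) % n ≡ (j +ℕ toℕ i) % n
  [j+turn]%n r j = begin
    (j +ℕ (r *ℕ n +ℕ toℕ i)) % n  ≡⟨ cong (λ v → (j +ℕ v) % n) (ℕP.+-comm (r *ℕ n) (toℕ i)) ⟩
    (j +ℕ (toℕ i +ℕ r *ℕ n)) % n  ≡⟨ cong (_% n) (sym (ℕP.+-assoc j (toℕ i) (r *ℕ n))) ⟩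
    (j +ℕ toℕ i +ℕ r *ℕ n) % n    ≡⟨ [m+kn]%n≡m%n (j +ℕ toℕ i) r n ⟩
    (j +ℕ toℕ i) % n              ∎
    where open ≡-Reasoning

  agentOf-turn : ∀ r → agentOf n (turn r) ≡ i
  agentOf-turn r = %≡⇒agentOf≡i (trans ([j+turn]%n r 0) (m<n⇒m%n≡m (FinP.toℕ<n i)))

  agentOf-inRound : ∀ r {j} → 0 < j → j < n → agentOf n (j +ℕ turn r) ≢ i
  agentOf-inRound r {j} 0<j j<n own = multiple-of-n ((j +ℕ toℕ i) div n) (sym j≡q*n)
    where
    [j+i]%n≡i : (j +ℕ toℕ i) % n ≡ toℕ i
    [j+i]%n≡i = trans (sym ([j+turn]%n r j)) (agentOf≡i⇒% own)
    j≡q*n : j ≡ (j +ℕ toℕ i) div n *ℕ n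
    j≡q*n = ℕP.+-cancelʳ-≡ (toℕ i) j _ (begin
      j +ℕ toℕ i                                      ≡⟨ m≡m%n+[m/n]*n (j +ℕ toℕ i) n ⟩
      (j +ℕ toℕ i) % n +ℕ (j +ℕ toℕ i) div n *ℕ n     ≡⟨ cong (_+ℕ (j +ℕ toℕ i) div n *ℕ n) [j+i]%n≡i ⟩
      toℕ i +ℕ (j +ℕ toℕ i) div n *ℕ n                ≡⟨ ℕP.+-comm (toℕ i) _ ⟩
      (j +ℕ toℕ i) div n *ℕ n +ℕ toℕ i                ∎)
      where open ≡-Reasoning
    multiple-of-n : ∀ q → q *ℕ n ≢ j
    multiple-of-n zero    q*n≡j = ℕP.<-irrefl q*n≡j 0<j
    multiple-of-n (suc q) q*n≡j = ℕP.<⇒≱ j<n (subst (n ≤ℕ_) q*n≡j (ℕP.m≤m+n n (q *ℕ n)))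

  agentOf-beforeFirst : ∀ {k} → k < toℕ i → agentOf n k ≢ i
  agentOf-beforeFirst {k} k<i own =
    ℕP.<-irrefl (trans (sym (m<n⇒m%n≡m (ℕP.<-trans k<i (FinP.toℕ<n i)))) (agentOf≡i⇒% own)) k<i

  turn-suc : ∀ r → turn (suc r) ≡ n +ℕ turn r
  turn-suc r = ℕP.+-assoc n (r *ℕ n) (toℕ i)

  turn-injective : ∀ {r r′} → turn r ≡ turn r′ → r ≡ r′
  turn-injective {r} {r′} eq = ℕP.*-cancelʳ-≡ r r′ n (ℕP.+-cancelʳ-≡ (toℕ i) (r *ℕ n) (r′ *ℕ n) eq)

  turn<numTurns : ∀ {m r} → r < rounds m → turn r < numTurns n m
  turn<numTurns {m} {r} r<R = begin-strict
    r *ℕ n +ℕ toℕ i  <⟨ ℕP.+-monoʳ-< (r *ℕ n) (FinP.toℕ<n i) ⟩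
    r *ℕ n +ℕ n      ≡⟨ ℕP.+-comm (r *ℕ n) n ⟩
    suc r *ℕ n       ≤⟨ ℕP.*-monoˡ-≤ n r<R ⟩
    rounds m *ℕ n    ∎
    where open ℕP.≤-Reasoning

  m≤numTurns : ∀ m → m ≤ℕ numTurns n m
  m≤numTurns m = ℕP.+-cancelʳ-≤ (n ∸ 1) m (rounds m *ℕ n) (begin
    m +ℕ (n ∸ 1)                                ≡⟨ m≡m%n+[m/n]*n (m +ℕ (n ∸ 1)) n ⟩
    (m +ℕ (n ∸ 1)) % n +ℕ rounds m *ℕ n          ≤⟨ ℕP.+-monoˡ-≤ (rounds m *ℕ n) %n≤n-1 ⟩
    (n ∸ 1) +ℕ rounds m *ℕ n                     ≡⟨ ℕP.+-comm (n ∸ 1) (rounds m *ℕ n) ⟩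
    rounds m *ℕ n +ℕ (n ∸ 1)                     ∎)
    where
    open ℕP.≤-Reasoning
    %n≤n-1 : (m +ℕ (n ∸ 1)) % n ≤ℕ n ∸ 1
    %n≤n-1 = ℕP.≤-pred (ℕP.≤-trans (m%n<n (m +ℕ (n ∸ 1)) n) (ℕP.≤-reflexive (sym (ℕP.suc-pred n))))

  turn-mono-≤ : ∀ {r r′} → r ≤ℕ r′ → turn r ≤ℕ turn r′
  turn-mono-≤ r≤r′ = ℕP.+-monoˡ-≤ (toℕ i) (ℕP.*-monoˡ-≤ n r≤r′)

chosen : Maybe (Fin m) → Subset m
chosen nothing  = ⊥
chosen (just y) = ⁅ y ⁆

∣chosen∣≤1 : (mc : Maybe (Fin m)) → ∣ chosen mc ∣ ≤ℕ 1
∣chosen∣≤1 {m} nothing = ℕP.≤-trans (ℕP.≤-reflexive (SubP.∣⊥∣≡0 m)) z≤n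
∣chosen∣≤1 (just y)    = ℕP.≤-reflexive (SubP.∣⁅x⁆∣≡1 y)

∣p∪chosen∣≤1+∣p∣ : ∀ (p : Subset m) mc → ∣ p ∪ chosen mc ∣ ≤ℕ suc ∣ p ∣
∣p∪chosen∣≤1+∣p∣ p mc = ℕP.≤-trans (∣p∪q∣≤∣p∣+∣q∣ p (chosen mc))
  (ℕP.≤-trans (ℕP.+-monoʳ-≤ ∣ p ∣ (∣chosen∣≤1 mc)) (ℕP.≤-reflexive (ℕP.+-comm ∣ p ∣ 1)))

∈chosen⁻ : ∀ {x : Fin m} mc → x ∈ chosen mc → mc ≡ just x
∈chosen⁻ nothing  x∈ = contradiction x∈ SubP.∉⊥
∈chosen⁻ (just y) x∈ = cong just (sym (SubP.x∈⁅y⁆⇒x≡y y x∈))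

removeChoice-⊆ : ∀ (mc : Maybe (Fin m)) Q → removeChoice mc Q ⊆ Q
removeChoice-⊆ nothing  Q = id
removeChoice-⊆ (just y) Q = SubP.p─q⊆p Q ⁅ y ⁆

⊆removeChoice∪chosen : ∀ (mc : Maybe (Fin m)) Q → Q ⊆ removeChoice mc Q ∪ chosen mc
⊆removeChoice∪chosen nothing  Q = SubP.p⊆p∪q ⊥
⊆removeChoice∪chosen (just y) Q {x} x∈Q with x Fin.≟ y
... | yes refl = SubP.q⊆p∪q (Q - x) ⁅ x ⁆ (SubP.x∈⁅x⁆ x)
... | no x≢y   = SubP.p⊆p∪q ⁅ y ⁆ (SubP.x∈p∧x≢y⇒x∈p-y x∈Q x≢y)

x∈p─q⇒x∉q : ∀ {x : Fin m} (p q : Subset m) → x ∈ p ─ q → x ∉ q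
x∈p─q⇒x∉q (_ ∷ p) (outside ∷ q) here        ()
x∈p─q⇒x∉q (_ ∷ p) (_ ∷ q)       (there x∈) (there x∈q) = x∈p─q⇒x∉q p q x∈ x∈q

y∉removeChoice : ∀ {y : Fin m} Q → y ∉ removeChoice (just y) Q
y∉removeChoice {y = y} Q y∈ = x∈p─q⇒x∉q Q ⁅ y ⁆ y∈ (SubP.x∈⁅x⁆ y)

addIf-⊇ : ∀ b (mc : Maybe (Fin m)) S → S ⊆ addIf b mc S
addIf-⊇ true  (just y) S = SubP.p⊆p∪q ⁅ y ⁆
addIf-⊇ true  nothing  S = id
addIf-⊇ false mc       S = id

addIf-⊆ : ∀ b (mc : Maybe (Fin m)) S → addIf b mc S ⊆ S ∪ chosen mc
addIf-⊆ true  (just y) S = id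
addIf-⊆ true  nothing  S = SubP.p⊆p∪q ⊥
addIf-⊆ false mc       S = SubP.p⊆p∪q (chosen mc)

addIf-nothing : ∀ b (S : Subset m) → addIf b nothing S ≡ S
addIf-nothing true  S = refl
addIf-nothing false S = refl

∣addIf∣≤ : ∀ b (mc : Maybe (Fin m)) S → ∣ addIf b mc S ∣ ≤ℕ suc ∣ S ∣
∣addIf∣≤ b mc S = ℕP.≤-trans (SubP.p⊆q⇒∣p∣≤∣q∣ (addIf-⊆ b mc S)) (∣p∪chosen∣≤1+∣p∣ S mc)

module Run (n m : ℕ) .{{_ : NonZero n}} (c : ℕ → Maybe (Fin m)) (i : Fin n) (ℓ : ℕ → Fin 2) where

  open Turns n i

  S : Fin 2 → ℕ → Subset m
  S = greedySet n m c i ℓ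

  avail-anti : ∀ {k k′} → k ≤ℕ k′ → avail c k′ ⊆ avail c k
  avail-anti = suc-monotone⇒monotone {_∼_ = flip _⊆_} (λ x∈ → x∈) (λ q⊆p r⊆q x∈ → q⊆p (r⊆q x∈)) (avail c)
                 (λ k → removeChoice-⊆ (c k) (avail c k))

  greedySet-mono : ∀ t {k k′} → k ≤ℕ k′ → S t k ⊆ S t k′
  greedySet-mono t = suc-monotone⇒monotone {_∼_ = _⊆_} (λ x∈ → x∈) (λ p⊆q q⊆r x∈ → q⊆r (p⊆q x∈)) (S t)
                       (λ k → addIf-⊇ (⌊ agentOf n k Fin.≟ i ⌋ ∧ ⌊ ℓ k Fin.≟ t ⌋) (c k) (S t k))

  greedySet-other : ∀ {k} t → agentOf n k ≢ i → S t (suc k) ≡ S t k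
  greedySet-other {k} t other =
    cong (λ b → addIf (b ∧ ⌊ ℓ k Fin.≟ t ⌋) (c k) (S t k)) (⌊⌋-false (agentOf n k Fin.≟ i) other)

  greedySet-own : ∀ {k} t → agentOf n k ≡ i → S t (suc k) ≡ addIf (⌊ ℓ k Fin.≟ t ⌋) (c k) (S t k)
  greedySet-own {k} t own =
    cong (λ b → addIf (b ∧ ⌊ ℓ k Fin.≟ t ⌋) (c k) (S t k)) (⌊⌋-true (agentOf n k Fin.≟ i) own)

  chosen∈greedySet : ∀ {k y} → agentOf n k ≡ i → c k ≡ just y → y ∈ S (ℓ k) (suc k)
  chosen∈greedySet {k} {y} own ck≡y rewrite greedySet-own (ℓ k) own | ⌊⌋-true (ℓ k Fin.≟ ℓ k) refl | ck≡y =
    SubP.q⊆p∪q (S (ℓ k) k) ⁅ y ⁆ (SubP.x∈⁅x⁆ y)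

  greedySet-beforeFirst : ∀ {k} t → k ≤ℕ toℕ i → S t k ≡ ⊥
  greedySet-beforeFirst {zero}  t _   = refl
  greedySet-beforeFirst {suc k} t k<i =
    trans (greedySet-other t (agentOf-beforeFirst k<i)) (greedySet-beforeFirst t (ℕP.<⇒≤ k<i))

  chosen∉avail : ∀ {k y} → c k ≡ just y → y ∉ avail c (suc k)
  chosen∉avail {k} ck≡y rewrite ck≡y = y∉removeChoice (avail c k)

  choice-injective : ValidRun n m c → ∀ {k k′ y} → k < numTurns n m → k′ < numTurns n m →
                     c k ≡ just y → c k′ ≡ just y → k ≡ k′
  choice-injective valid {k} {k′} {y} k<T k′<T ck≡y ck′≡y with ℕP.<-cmp k k′
  ... | tri≈ _ k≡k′ _ = k≡k′
  ... | tri< k<k′ _ _ = contradiction (avail-anti k<k′ (valid k′ y k′<T ck′≡y)) (chosen∉avail ck≡y)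
  ... | tri> _ _ k′<k = contradiction (avail-anti k′<k (valid k y k<T ck≡y)) (chosen∉avail ck′≡y)

  TakenByOthers : ℕ → Fin m → Set
  TakenByOthers K x = x ∈ avail c (toℕ i) × x ∉ avail c K × (∀ t → x ∉ S t K)

  takenByOthers? : ∀ K → Decidable (TakenByOthers K)
  takenByOthers? K x =
    x SubP.∈? avail c (toℕ i) ×-dec ¬? (x SubP.∈? avail c K) ×-dec FinP.all? (λ t → ¬? (x SubP.∈? S t K))

  takenByOthers : ℕ → Subset m
  takenByOthers K = select (takenByOthers? K)

  takenByOthers-suc : ∀ k → takenByOthers (suc k) ⊆ takenByOthers k ∪ chosen (c k)
  takenByOthers-suc k {x} x∈ with ∈-select⁻ (takenByOthers? (suc k)) x∈
  ... | x∈av , x∉av′ , x∉S′ with x SubP.∈? avail c k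
  ...   | no x∉av = SubP.p⊆p∪q (chosen (c k)) (∈-select⁺ (takenByOthers? k)
                      (x∈av , x∉av , λ t → x∉S′ t ∘ greedySet-mono t (ℕP.n≤1+n k)))
  ...   | yes x∈av with SubP.x∈p∪q⁻ _ _ (⊆removeChoice∪chosen (c k) (avail c k) x∈av)
  ...     | inj₁ x∈av′     = contradiction x∈av′ x∉av′
  ...     | inj₂ x∈chosen = SubP.q⊆p∪q _ _ x∈chosen

  takenByOthers-own : ∀ {k} → agentOf n k ≡ i → takenByOthers (suc k) ⊆ takenByOthers k
  takenByOthers-own {k} own {x} x∈ with SubP.x∈p∪q⁻ _ _ (takenByOthers-suc k x∈)
  ... | inj₁ x∈W       = x∈W
  ... | inj₂ x∈chosen = contradiction (chosen∈greedySet own (∈chosen⁻ (c k) x∈chosen))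
                                      (proj₂ (proj₂ (∈-select⁻ (takenByOthers? (suc k)) x∈)) (ℓ k))

  ∣takenByOthers-suc∣≤ : ∀ k → ∣ takenByOthers (suc k) ∣ ≤ℕ suc ∣ takenByOthers k ∣
  ∣takenByOthers-suc∣≤ k =
    ℕP.≤-trans (SubP.p⊆q⇒∣p∣≤∣q∣ (takenByOthers-suc k)) (∣p∪chosen∣≤1+∣p∣ (takenByOthers k) (c k))

  picks : ℕ → ℕ
  picks K = ∣ S 0F K ∣ +ℕ ∣ S (1+F 0F) K ∣

  picks-other : ∀ {k} → agentOf n k ≢ i → picks (suc k) ≡ picks k
  picks-other other = cong₂ (λ A B → ∣ A ∣ +ℕ ∣ B ∣) (greedySet-other 0F other) (greedySet-other (1+F 0F) other)

  picks-own : ∀ {k} → agentOf n k ≡ i → picks (suc k) ≤ℕ suc (picks k)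
  picks-own {k} own rewrite greedySet-own 0F own | greedySet-own (1+F 0F) own with ℓ k
  ... | 0F      = ℕP.+-monoˡ-≤ ∣ S (1+F 0F) k ∣ (∣addIf∣≤ true (c k) (S 0F k))
  ... | 1+F 0F = ℕP.≤-trans (ℕP.+-monoʳ-≤ ∣ S 0F k ∣ (∣addIf∣≤ true (c k) (S (1+F 0F) k)))
                             (ℕP.≤-reflexive (ℕP.+-suc ∣ S 0F k ∣ ∣ S (1+F 0F) k ∣))

  ∣takenByOthers∣-inRound : ∀ r j → j < n →
                            ∣ takenByOthers (suc j +ℕ turn r) ∣ ≤ℕ j +ℕ ∣ takenByOthers (turn r) ∣
  ∣takenByOthers∣-inRound r zero    _   = SubP.p⊆q⇒∣p∣≤∣q∣ (takenByOthers-own (agentOf-turn r))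
  ∣takenByOthers∣-inRound r (suc j) j<n =
    ℕP.≤-trans (∣takenByOthers-suc∣≤ (suc j +ℕ turn r)) (s≤s (∣takenByOthers∣-inRound r j (ℕP.<⇒≤ j<n)))

  picks-inRound : ∀ r j → j < n → picks (suc j +ℕ turn r) ≤ℕ suc (picks (turn r))
  picks-inRound r zero    _   = picks-own (agentOf-turn r)
  picks-inRound r (suc j) j<n =
    ℕP.≤-trans (ℕP.≤-reflexive (picks-other (agentOf-inRound r (s≤s z≤n) j<n))) (picks-inRound r j (ℕP.<⇒≤ j<n))

  private
    n-1+1+turn : ∀ r → suc (pred n) +ℕ turn r ≡ turn (suc r)
    n-1+1+turn r = trans (cong (_+ℕ turn r) (ℕP.suc-pred n)) (sym (turn-suc r))

    n-1<n : pred n < n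
    n-1<n = ℕP.≤-reflexive (ℕP.suc-pred n)

  ∣takenByOthers-turn∣≤ : ∀ r → ∣ takenByOthers (turn r) ∣ ≤ℕ r *ℕ pred n
  ∣takenByOthers-turn∣≤ zero = ℕP.≤-trans (SubP.p⊆q⇒∣p∣≤∣q∣ empty) (ℕP.≤-reflexive (SubP.∣⊥∣≡0 m))
    where
    empty : takenByOthers (toℕ i) ⊆ ⊥
    empty x∈ with ∈-select⁻ (takenByOthers? (toℕ i)) x∈
    ... | x∈av , x∉av , _ = contradiction x∈av x∉av
  ∣takenByOthers-turn∣≤ (suc r) = subst (λ K → ∣ takenByOthers K ∣ ≤ℕ suc r *ℕ pred n) (n-1+1+turn r)
    (ℕP.≤-trans (∣takenByOthers∣-inRound r (pred n) n-1<n) (ℕP.+-monoʳ-≤ (pred n) (∣takenByOthers-turn∣≤ r)))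

  picks-turn≤ : ∀ r → picks (turn r) ≤ℕ r
  picks-turn≤ zero rewrite greedySet-beforeFirst 0F ℕP.≤-refl | greedySet-beforeFirst (1+F 0F) ℕP.≤-refl
                         | SubP.∣⊥∣≡0 m = z≤n
  picks-turn≤ (suc r) = subst (λ K → picks K ≤ℕ suc r) (n-1+1+turn r)
    (ℕP.≤-trans (picks-inRound r (pred n) n-1<n) (s≤s (picks-turn≤ r)))

-- The greedy agent and the charging argument

module Greedy (n m : ℕ) .{{_ : NonZero n}} (c : ℕ → Maybe (Fin m)) (i : Fin n) (ℓ : ℕ → Fin 2)
              (f : Subset m → ℚ) (I : Subset m → Bool) (indSys : IsIndependenceSystem I)
              (greedy : FollowsGreedy n m c i f I ℓ) where

  open Run n m c i ℓ

  hereditary : ∀ A B → A ⊆ B → Indep I B → Indep I A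
  hereditary = proj₂ indSys

  greedySet-indep : ∀ t {k} → k ≤ℕ numTurns n m → Indep I (S t k)
  greedySet-indep t {zero}  _   = proj₁ indSys
  greedySet-indep t {suc k} k<T with agentOf n k Fin.≟ i
  ... | no _    = greedySet-indep t (ℕP.<⇒≤ k<T)
  ... | yes own with greedy k k<T own
  ...   | inj₁ (ck≡nothing , _) rewrite ck≡nothing =
    subst (Indep I) (sym (addIf-nothing ⌊ ℓ k Fin.≟ t ⌋ (S t k))) (greedySet-indep t (ℕP.<⇒≤ k<T))
  ...   | inj₂ (j , ck≡j , _ , indS+j , _) rewrite ck≡j with ℓ k Fin.≟ t
  ...     | yes refl = indS+j
  ...     | no _     = greedySet-indep t (ℕP.<⇒≤ k<T)

  Addable : Fin m → ℕ → Set
  Addable x k = x ∈ avail c k × (∀ t → Indep I (S t k ∪ ⁅ x ⁆))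

  addable? : ∀ x k → Dec (Addable x k)
  addable? x k = x SubP.∈? avail c k ×-dec FinP.all? (λ t → T? (I (S t k ∪ ⁅ x ⁆)))

  Addable-anti : ∀ {x k k′} → k ≤ℕ k′ → Addable x k′ → Addable x k
  Addable-anti {x} {k} {k′} k≤k′ (x∈av , indep) =
    avail-anti k≤k′ x∈av , λ t → hereditary _ _ (S+x⊆S′+x t) (indep t)
    where
    S+x⊆S′+x : ∀ t → S t k ∪ ⁅ x ⁆ ⊆ S t k′ ∪ ⁅ x ⁆
    S+x⊆S′+x t = p∪⁅x⁆⊆q (SubP.p⊆p∪q ⁅ x ⁆ ∘ greedySet-mono t k≤k′) (SubP.q⊆p∪q _ ⁅ x ⁆ (SubP.x∈⁅x⁆ x))

  greedy-choice : ∀ {k x} → k < numTurns n m → agentOf n k ≡ i → Addable x k →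
                  Σ (Fin m) λ j → c k ≡ just j × (∀ t → marg f x (S t k) ≤ marg f j (S (ℓ k) k))
  greedy-choice {k} {x} k<T own (x∈av , indep) with greedy k k<T own
  ... | inj₁ (_ , stuck)                 = contradiction (indep 0F) (stuck x 0F x∈av)
  ... | inj₂ (j , ck≡j , _ , _ , best) = j , ck≡j , λ t → best x t x∈av (indep t)

  greedy-choice-indep : ∀ {k j} → k < numTurns n m → agentOf n k ≡ i → c k ≡ just j → Indep I ⁅ j ⁆
  greedy-choice-indep {k} {j} k<T own ck≡j with greedy k k<T own
  ... | inj₁ (ck≡nothing , _) = contradiction (trans (sym ck≡j) ck≡nothing) λ ()
  ... | inj₂ (j′ , ck≡j′ , _ , indS+j′ , _) rewrite just-injective (trans (sym ck≡j) ck≡j′) =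
    hereditary ⁅ j′ ⁆ _ (SubP.q⊆p∪q _ ⁅ j′ ⁆) indS+j′

module Charging (n m : ℕ) .{{_ : NonZero n}} (c : ℕ → Maybe (Fin m)) (i : Fin n) (ℓ : ℕ → Fin 2)
                (f : Subset m → ℚ) (I : Subset m → Bool) (p : ℚ) (isP : IsPSystem p I)
                (greedy : FollowsGreedy n m c i f I ℓ)
                (valid : ValidRun n m c) (O : Subset m) (indO : Indep I O) (O⊆ : O ⊆ avail c (toℕ i)) where

  open Turns n i
  open Run n m c i ℓ
  open Greedy n m c i ℓ f I (proj₁ isP) greedy

  lifetime : Fin m → ℕ
  lifetime x = prefixLength (λ r → addable? x (turn r)) (rounds m)

  addable-during-lifetime : ∀ {x r} → r < lifetime x → Addable x (turn r)
  addable-during-lifetime {x} = <prefixLength⇒ (λ r → addable? x (turn r)) (rounds m)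

  unaddable-after-lifetime : ∀ {x r} → lifetime x ≤ℕ r → r < rounds m → ¬ Addable x (turn r)
  unaddable-after-lifetime {x} =
    prefixLength≤⇒¬ (λ r → addable? x (turn r)) (Addable-anti ∘ turn-mono-≤) (rounds m)

  Blocked : Fin 2 → ℕ → Fin m → Set
  Blocked t K z = z ∈ O × (z ∈ S t K ⊎ ¬ Indep I (S t K ∪ ⁅ z ⁆))

  blocked? : ∀ t K → Decidable (Blocked t K)
  blocked? t K z = z SubP.∈? O ×-dec (z SubP.∈? S t K ⊎-dec ¬? (T? (I (S t K ∪ ⁅ z ⁆))))

  blocked : Fin 2 → ℕ → Subset m
  blocked t K = select (blocked? t K)

  P : ℕ
  P = ⌊ p ⌋ℕ

  ∣blocked∣≤ : ∀ t {K} → K ≤ℕ numTurns n m → ∣ blocked t K ∣ ≤ℕ suc P *ℕ ∣ S t K ∣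
  ∣blocked∣≤ t {K} K≤T = toℚ≤p*toℚ⇒≤ (suc P)
    (∣blocked∣≤p*∣S∣ {p = p} isP (greedySet-indep t K≤T)
                                 (hereditary _ O (proj₁ ∘ ∈-blocked) indO) (proj₂ ∘ ∈-blocked))
    (ℚP.<⇒≤ (p<toℚ[1+⌊p⌋ℕ] p))
    where
    ∈-blocked : ∀ {z} → z ∈ blocked t K → Blocked t K z
    ∈-blocked = ∈-select⁻ (blocked? t K)

  blocked-or-taken : ∀ {z K} → z ∈ O → ¬ Addable z K → (Σ (Fin 2) λ t → Blocked t K z) ⊎ TakenByOthers K z
  blocked-or-taken {z} {K} z∈O unaddable with FinP.any? (λ t → blocked? t K z)
  ... | yes some-blocked = inj₁ some-blocked
  ... | no none-blocked  = inj₂ (O⊆ z∈O , z∉avail , z∉S)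
    where
    z∉S : ∀ t → z ∉ S t K
    z∉S t z∈S = none-blocked (t , z∈O , inj₁ z∈S)
    z∉avail : z ∉ avail c K
    z∉avail z∈avail = unaddable (z∈avail , λ t →
      decidable-stable (T? (I (S t K ∪ ⁅ z ⁆))) (λ dependent → none-blocked (t , z∈O , inj₂ dependent)))

  Expired : ℕ → Fin m → Set
  Expired r z = z ∈ O × lifetime z ≤ℕ r

  expired? : ∀ r → Decidable (Expired r)
  expired? r z = z SubP.∈? O ×-dec lifetime z ℕP.≤? r

  expiredBy : ℕ → Subset m
  expiredBy r = select (expired? r)

  expiredBy⊆ : ∀ {r} → r < rounds m →
               expiredBy r ⊆ takenByOthers (turn r) ∪ (blocked 0F (turn r) ∪ blocked (1+F 0F) (turn r))
  expiredBy⊆ {r} r<R z∈ with ∈-select⁻ (expired? r) z∈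
  ... | z∈O , lz≤r with blocked-or-taken {K = turn r} z∈O (unaddable-after-lifetime lz≤r r<R)
  ...   | inj₂ taken          = SubP.p⊆p∪q _ (∈-select⁺ (takenByOthers? (turn r)) taken)
  ...   | inj₁ (0F , bl)      = SubP.q⊆p∪q W _ (SubP.p⊆p∪q _ (∈-select⁺ (blocked? 0F (turn r)) bl))
    where W = takenByOthers (turn r)
  ...   | inj₁ (1+F 0F , bl) =
    SubP.q⊆p∪q W _ (SubP.q⊆p∪q (blocked 0F (turn r)) _ (∈-select⁺ (blocked? (1+F 0F) (turn r)) bl))
    where W = takenByOthers (turn r)

  -- C = n + P, written so that the instance NonZero C is found
  C : ℕ
  C = suc (pred n +ℕ P)

  ∣expiredBy∣≤ : ∀ {r} → r ≤ℕ rounds m → ∣ expiredBy r ∣ ≤ℕ r *ℕ C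
  ∣expiredBy∣≤ {r} r≤R with ℕP.m≤n⇒m<n∨m≡n r≤R
  ... | inj₂ refl = begin
    ∣ expiredBy r ∣  ≤⟨ SubP.∣p∣≤n (expiredBy r) ⟩
    m                ≤⟨ m≤numTurns m ⟩
    r *ℕ n           ≡⟨ cong (r *ℕ_) (sym (ℕP.suc-pred n)) ⟩
    r *ℕ suc (pred n) ≤⟨ ℕP.*-monoʳ-≤ r (s≤s (ℕP.m≤m+n (pred n) P)) ⟩
    r *ℕ C           ∎
    where open ℕP.≤-Reasoning
  ... | inj₁ r<R = begin
    ∣ expiredBy r ∣
      ≤⟨ SubP.p⊆q⇒∣p∣≤∣q∣ (expiredBy⊆ r<R) ⟩
    ∣ W ∪ (B₀ ∪ B₁) ∣
      ≤⟨ ℕP.≤-trans (∣p∪q∣≤∣p∣+∣q∣ W (B₀ ∪ B₁)) (ℕP.+-monoʳ-≤ ∣ W ∣ (∣p∪q∣≤∣p∣+∣q∣ B₀ B₁)) ⟩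
    ∣ W ∣ +ℕ (∣ B₀ ∣ +ℕ ∣ B₁ ∣)
      ≤⟨ ℕP.+-mono-≤ (∣takenByOthers-turn∣≤ r) (ℕP.+-mono-≤ (∣blocked∣≤ 0F K≤T) (∣blocked∣≤ (1+F 0F) K≤T)) ⟩
    r *ℕ pred n +ℕ (suc P *ℕ ∣ S 0F K ∣ +ℕ suc P *ℕ ∣ S (1+F 0F) K ∣)
      ≡⟨ cong (r *ℕ pred n +ℕ_) (sym (ℕP.*-distribˡ-+ (suc P) ∣ S 0F K ∣ ∣ S (1+F 0F) K ∣)) ⟩
    r *ℕ pred n +ℕ suc P *ℕ picks K
      ≤⟨ ℕP.+-monoʳ-≤ (r *ℕ pred n) (ℕP.*-monoʳ-≤ (suc P) (picks-turn≤ r)) ⟩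
    r *ℕ pred n +ℕ suc P *ℕ r
      ≡⟨ solve 3 (λ r n-1 P → r :* n-1 :+ (con 1 :+ P) :* r := r :* (con 1 :+ (n-1 :+ P))) refl r (pred n) P ⟩
    r *ℕ C ∎
    where
    open ℕP.≤-Reasoning
    open Data.Nat.Solver.+-*-Solver
    K : ℕ
    K = turn r
    K≤T : K ≤ℕ numTurns n m
    K≤T = ℕP.<⇒≤ (turn<numTurns r<R)
    W B₀ B₁ : Subset m
    W  = takenByOthers K
    B₀ = blocked 0F K
    B₁ = blocked (1+F 0F) K

  open LexKey lifetime
  open Rank O lexKey

  rank<∣expiredBy∣ : ∀ {x} → x ∈ O → rank x < ∣ expiredBy (lifetime x) ∣
  rank<∣expiredBy∣ {x} x∈O =
    SubP.p⊂q⇒∣p∣<∣q∣ (below⊆expired , x , ∈-select⁺ (expired? (lifetime x)) (x∈O , ℕP.≤-refl) , x∉below)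
    where
    below⊆expired : keyBelow x ⊆ expiredBy (lifetime x)
    below⊆expired z∈ with ∈-select⁻ (keyBelow? x) z∈
    ... | z∈O , kz<kx = ∈-select⁺ (expired? (lifetime x)) (z∈O , lexKey-<⇒≤ kz<kx)
    x∉below : x ∉ keyBelow x
    x∉below x∈ = ℕP.<-irrefl refl (proj₂ (∈-select⁻ (keyBelow? x) x∈))

  -- opaque: letting the checker unfold rank x div C (say in avail c (chargeTurn x)) is ruinously slow
  opaque
    chargeRound : Fin m → ℕ
    chargeRound x = rank x div C

    chargeRound<lifetime : ∀ {x} → x ∈ O → chargeRound x < lifetime x
    chargeRound<lifetime {x} x∈O = m<n*o⇒m/o<n (ℕP.<-≤-trans (rank<∣expiredBy∣ x∈O)
      (∣expiredBy∣≤ (prefixLength≤ (λ r → addable? x (turn r)) (rounds m))))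

    chargeRound-determines-rank : ∀ {x z} → chargeRound x ≡ chargeRound z → rank x % C ≡ rank z % C →
                                  rank x ≡ rank z
    chargeRound-determines-rank = /-%-injective

  chargeTurn : Fin m → ℕ
  chargeTurn x = turn (chargeRound x)

  chargeTurn<numTurns : ∀ {x} → x ∈ O → chargeTurn x < numTurns n m
  chargeTurn<numTurns {x} x∈O = turn<numTurns (ℕP.<-≤-trans (chargeRound<lifetime x∈O)
    (prefixLength≤ (λ r → addable? x (turn r)) (rounds m)))

  -- the default x is never used for x ∈ O, whose charge turn is a turn where the agent picks an item
  δ : Fin m → Fin m
  δ x = fromMaybe x (c (chargeTurn x))

  charged-choice : ∀ {x} → x ∈ O → c (chargeTurn x) ≡ just (δ x) ×
                   (∀ t → marg f x (S t (chargeTurn x)) ≤ marg f (δ x) (S (ℓ (chargeTurn x)) (chargeTurn x)))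
  charged-choice {x} x∈O with greedy-choice (chargeTurn<numTurns x∈O) (agentOf-turn (chargeRound x))
                                (addable-during-lifetime (chargeRound<lifetime x∈O))
  ... | j , cK≡j , dominates = subst Dominated (sym (cong (fromMaybe x) cK≡j)) (cK≡j , dominates)
    where
    K = chargeTurn x
    Dominated : Fin m → Set
    Dominated y = c K ≡ just y × (∀ t → marg f x (S t K) ≤ marg f y (S (ℓ K) K))

  δ∈finalSets : ∀ {x} → x ∈ O → δ x ∈ finalSet n m c i ℓ 0F ∪ finalSet n m c i ℓ (1+F 0F)
  δ∈finalSets {x} x∈O = in-final (ℓ K) (greedySet-mono (ℓ K) (chargeTurn<numTurns x∈O)
                          (chosen∈greedySet (agentOf-turn (chargeRound x)) (proj₁ (charged-choice x∈O))))
    where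
    K = chargeTurn x
    in-final : ∀ t {y} → y ∈ S t (numTurns n m) → y ∈ finalSet n m c i ℓ 0F ∪ finalSet n m c i ℓ (1+F 0F)
    in-final 0F       = SubP.p⊆p∪q _
    in-final (1+F 0F) = SubP.q⊆p∪q _ _

  chargeTurn-unique : ∀ {x k} → x ∈ O → k < numTurns n m → c k ≡ just (δ x) → chargeTurn x ≡ k
  chargeTurn-unique x∈O k<T ck≡δx =
    choice-injective valid (chargeTurn<numTurns x∈O) k<T (proj₁ (charged-choice x∈O)) ck≡δx

  δ-dominates : ∀ {x k} → x ∈ O → k < numTurns n m → c k ≡ just (δ x) →
                ∀ t → marg f x (S t k) ≤ marg f (δ x) (S (ℓ k) k)
  δ-dominates {x} x∈O k<T ck≡δx = subst (λ K → ∀ t → marg f x (S t K) ≤ marg f (δ x) (S (ℓ K) K))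
                                        (chargeTurn-unique x∈O k<T ck≡δx) (proj₂ (charged-choice x∈O))

  ∣preimage∣≤C : ∀ {k y D} → k < numTurns n m → c k ≡ just y → D ⊆ O → ∣ preimage δ y D ∣ ≤ℕ C
  ∣preimage∣≤C {k} {y} {D} k<T ck≡y D⊆O = injective⇒∣p∣≤ (preimage δ y D) (λ x _ → rank x mod C) mod-injective
    where
    chargeRound≡ : ∀ {x} → x ∈ preimage δ y D → turn (chargeRound x) ≡ k
    chargeRound≡ x∈ with ∈preimage⁻ x∈
    ... | x∈D , refl = chargeTurn-unique (D⊆O x∈D) k<T ck≡y
    mod-injective : ∀ {x z} (x∈ : x ∈ preimage δ y D) (z∈ : z ∈ preimage δ y D) →
                    rank x mod C ≡ rank z mod C → x ≡ z
    mod-injective {x} {z} x∈ z∈ eq =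
      rank-injective lexKey-injective (D⊆O (proj₁ (∈preimage⁻ x∈))) (D⊆O (proj₁ (∈preimage⁻ z∈)))
      (chargeRound-determines-rank (turn-injective (trans (chargeRound≡ x∈) (sym (chargeRound≡ z∈))))
        (trans (sym (FinP.toℕ-fromℕ< _)) (trans (cong toℕ eq) (FinP.toℕ-fromℕ< _))))

  ∣preimage∣≤n+p : ∀ {k y D} → k < numTurns n m → agentOf n k ≡ i → c k ≡ just y → D ⊆ O →
                   toℚ ∣ preimage δ y D ∣ ≤ toℚ n + p
  ∣preimage∣≤n+p {k} {y} {D} k<T own ck≡y D⊆O = begin
    toℚ ∣ preimage δ y D ∣  ≤⟨ toℚ-mono-≤ (∣preimage∣≤C k<T ck≡y D⊆O) ⟩
    toℚ C                  ≡⟨ cong (λ n′ → toℚ (n′ +ℕ P)) (ℕP.suc-pred n) ⟩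
    toℚ (n +ℕ P)           ≡⟨ toℚ-+ n P ⟩
    toℚ n + toℚ P          ≤⟨ ℚP.+-monoʳ-≤ (toℚ n) (toℚ⌊p⌋ℕ≤p 0≤p) ⟩
    toℚ n + p              ∎
    where
    open ℚP.≤-Reasoning
    0≤p : 0ℚ ≤ p
    0≤p = ℚP.≤-trans (toℚ-mono-≤ {0} {1} z≤n) (1≤p isP (greedy-choice-indep k<T own ck≡y))

lemma2 : (n m : ℕ) .{{_ : NonZero n}} (c : ℕ → Maybe (Fin m)) (i : Fin n)
    (f : Subset m → ℚ) (I : Subset m → Bool) (p : ℚ) (ℓ : ℕ → Fin 2) →
    Normalized f → NonNegative f → Submodular f → IsPSystem p I →
    ValidRun n m c → FollowsGreedy n m c i f I ℓ →
    (O : Subset m) → Indep I O → O ⊆ avail c (toℕ i) →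
    (∀ S → Indep I S → S ⊆ avail c (toℕ i) → f S ≤ f O) →
    Σ (Fin m → Fin m) (λ δ →
      (∀ x → x ∈ (O ─ Zset n m c i f ℓ O) →
        δ x ∈ (finalSet n m c i ℓ Data.Fin.zero ∪ finalSet n m c i ℓ (Data.Fin.suc Data.Fin.zero))) ×
      (∀ k y → k < numTurns n m → agentOf n k ≡ i → c k ≡ just y →
        (∀ x → x ∈ (O ─ Zset n m c i f ℓ O) → δ x ≡ y → ∀ t →
           marg f x (greedySet n m c i ℓ t k) ≤ marg f y (greedySet n m c i ℓ (ℓ k) k)) ×
        toℚ ∣ preimage δ y (O ─ Zset n m c i f ℓ O) ∣ ≤ toℚ n + p))
lemma2 n m c i f I p ℓ _ _ _ isP valid greedy O indO O⊆ _ =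
  δ , (λ x x∈ → δ∈finalSets (O─Z⊆O x∈)) ,
  λ k y k<T own ck≡y →
    (λ { x x∈ refl → δ-dominates (O─Z⊆O x∈) k<T ck≡y }) ,
    ∣preimage∣≤n+p k<T own ck≡y O─Z⊆O
  where
  open Charging n m c i ℓ f I p isP greedy valid O indO O⊆
  O─Z⊆O : O ─ Zset n m c i f ℓ O ⊆ O
  O─Z⊆O = SubP.p─q⊆p O (Zset n m c i f ℓ O)
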